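{- Let $n,k$ be integers with $8\le 2k\le n-2$, and put $d=n-2k+1$. Let $\eta=(\eta_1<\dots<\eta_l)\in\mathbb{D}_k$, and let $Y_{2\eta^*}$ be the Young diagram whose main diagonal consists of exactly the $l+1$ cells $c_{1,1},\dots,c_{l+1,l+1}$ and which satisfies $h_{1,1}=2n-4$, $h_{i,i}=2\eta_{l-(i-2)}$ for $2\le i\le l+1$, and $a(c_{i,i})=l(c_{i,i})+1$ for $1\le i\le l+1$. Let $\lambda$ be the partition whose parts are the hook lengths of the cells of the first column of $Y_{2\eta^*}$ (equivalently the complement in $\mathbb{N}_0$ of the numerical set whose Keith--Nath diagram is $Y_{2\eta^*}$). Then $\lambda$ is unrefinable. In particular, $\lambda\in\overline{\mathcal{U}}_{T_{n,n-2k+1}}$ if $d=3$, and $\lambda\in\overline{\mathcal{U}}_{T_{n,n-2k+1}}\setminus\{\zeta_{n,k}\}$ if $d>3$, where $\zeta_{n,k}=(1,2,\dots,n-k-3,\,n-k-1,\dots,n-3,\,n-2+k,\,2n-4)$.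
   Context: A partition of $N$ into distinct parts is a sequence $\lambda=(\lambda_1<\dots<\lambda_t)$ of positive integers with $t\ge 2$ and $\sum\lambda_i=N$; $\mathbb{D}_N$ is the set of such partitions. Missing parts: $\mathcal{M}_\lambda=\{1,\dots,\lambda_t\}\setminus\{\lambda_1,\dots,\lambda_t\}$. $\lambda$ is refinable if there are two distinct missing parts whose sum is a part of $\lambda$, unrefinable otherwise. An unrefinable partition of $N$ is maximal if its largest part is maximum among unrefinable partitions of $N$; $\overline{\mathcal{U}}_N$ is the set of maximal unrefinable partitions $\lambda$ of $N$ with $\#\mathcal{M}_\lambda=\lfloor\lambda_t/2\rfloor$. $T_n=n(n+1)/2$, $T_{n,d}=T_n-d$. Young diagrams in English convention; $c_{i,j}$ is the cell in row $i$, column $j$; arm $a$ = cells to the right, leg $l$ = cells below, hook $h_{i,j}=a(c_{i,j})+l(c_{i,j})+1$. Keith--Nath: for a numerical set $S$ (a subset of $\mathbb{N}_0$ containing $0$ with finite complement), its diagram has one row per gap $g\notin S$, ordered top to bottom by decreasing $g$, the row of $g$ having $\#\{s\in S:s<g\}$ cells; first-column hook lengths are exactly the gaps. -}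

module Defs where

open import Data.Nat using (ℕ; zero; suc; _+_; _*_; _∸_; _≤_; _<_; _≥_; _≤?_; _≟_)
open import Data.Nat.DivMod using (_/_)
open import Data.Nat.ListAction using (sum)
open import Data.List using (List; []; _∷_; length; map; filter; reverse; upTo; _++_)
open import Data.List.Relation.Unary.All using (All)
open import Data.List.Relation.Unary.Linked using (Linked)
open import Data.List.Membership.Propositional using (_∈_; _∉_)
open import Data.List.Membership.DecPropositional _≟_ using (_∉?_)
open import Data.Product using (_×_; Σ; ∃)
open import Relation.Nullary using (¬_)
open import Relation.Binary.PropositionalEquality using (_≡_; _≢_)

-- 1-indexed lookup: at xs i = x_i for 1 ≤ i ≤ length xs, and 0 otherwise.
at : List ℕ → ℕ → ℕ
at []       _             = 0
at (x ∷ xs) zero          = 0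
at (x ∷ xs) (suc zero)    = x
at (x ∷ xs) (suc (suc i)) = at xs (suc i)

-- fromTo a b = [a, a+1, ..., b]  (empty if b < a)
fromTo : ℕ → ℕ → List ℕ
fromTo a b = map (a +_) (upTo (suc b ∸ a))

DistinctPartition : ℕ → List ℕ → Set
DistinctPartition N p =
  All (1 ≤_) p × Linked _<_ p × 2 ≤ length p × sum p ≡ N

largest : List ℕ → ℕ
largest p = at p (length p)

Missing : List ℕ → ℕ → Set
Missing p m = 1 ≤ m × m ≤ largest p × m ∉ p

numMissing : List ℕ → ℕ
numMissing p = length (filter (_∉? p) (fromTo 1 (largest p)))

Refinable : List ℕ → Set
Refinable p = Σ ℕ λ m₁ → Σ ℕ λ m₂ →
  Missing p m₁ × Missing p m₂ × m₁ ≢ m₂ × (m₁ + m₂) ∈ p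

Unrefinable : List ℕ → Set
Unrefinable p = ¬ Refinable p

MaximalUnrefinable : ℕ → List ℕ → Set
MaximalUnrefinable N p =
  DistinctPartition N p × Unrefinable p ×
  ((μ : List ℕ) → DistinctPartition N μ → Unrefinable μ → largest μ ≤ largest p)

InUbar : ℕ → List ℕ → Set
InUbar N p = MaximalUnrefinable N p × numMissing p ≡ largest p / 2

T : ℕ → ℕ
T n = (n * suc n) / 2

T₂ : ℕ → ℕ → ℕ
T₂ n d = T n ∸ d

ζ : ℕ → ℕ → List ℕ
ζ n k = fromTo 1 (n ∸ k ∸ 3) ++ fromTo (n ∸ k ∸ 1) (n ∸ 3) ++
        ((n ∸ 2) + k) ∷ (2 * n ∸ 4) ∷ []

-- Young diagrams (English convention), given by row lengths μ₁ ≥ μ₂ ≥ … > 0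

YoungDiagram : List ℕ → Set
YoungDiagram Y = All (1 ≤_) Y × Linked _≥_ Y

rowLen : List ℕ → ℕ → ℕ
rowLen Y i = at Y i

colLen : List ℕ → ℕ → ℕ
colLen Y j = length (filter (j ≤?_) Y)

InDiagram : List ℕ → ℕ → ℕ → Set
InDiagram Y i j = 1 ≤ i × 1 ≤ j × j ≤ rowLen Y i

arm : List ℕ → ℕ → ℕ → ℕ
arm Y i j = rowLen Y i ∸ j

leg : List ℕ → ℕ → ℕ → ℕ
leg Y i j = colLen Y j ∸ i

hook : List ℕ → ℕ → ℕ → ℕ
hook Y i j = arm Y i j + leg Y i j + 1

firstColHooks : List ℕ → List ℕ
firstColHooks Y = reverse (map (λ i → hook Y i 1) (fromTo 1 (length Y)))

{-# OPTIONS --safe #-}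
-- The first-column hooks of a Young diagram with r rows are its beta-numbers Y_i + r − i.
-- If the diagonal cells have arms α_p and legs β_p (p < d), these are the numbers r + α_p
-- together with the v < r different from every r − 1 − β_p (Frobenius).  For Y_{2η*} the arms
-- are r, η_l, …, η_1, every leg is one less than its arm and r = n − 2, so λ consists of 2r,
-- the r + η_i and the v ∈ [1, r) with r − v ∉ η.  The missing parts are then r, the r − η_i
-- and the r + w with w ∉ η; because every η_i < k and 2k ≤ r, no sum of two distinct missing
-- parts equals 2r, some r + η_i, or a number below r, so λ is unrefinable.  Adding r and the
-- r − η_i to λ gives each of 1, …, r, 2r and the r + η_i exactly once, hence
-- |λ| = T_r + r + 2k = T_{n,n−2k+1}.  An unrefinable μ whose largest part t exceeds 2r contains
-- x or t − x for every x ≤ r, so |μ| ≥ t + T_r > |λ|: λ has the maximal largest part 2r, and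
-- it misses 2r − r = r numbers.

module Submission where

open import Defs
open import Data.Nat using (ℕ; zero; suc; _+_; _*_; _∸_; _≤_; _<_; _≥_; z≤n; s≤s; _≤?_; _≟_; _<?_)
open import Data.Nat.Properties
open import Data.Nat.DivMod using (_/_; m*n/n≡m; +-distrib-/-∣ʳ)
open import Data.Nat.Divisibility using (divides-refl)
open import Data.Nat.Tactic.RingSolver using (solve-∀)
open import Data.Nat.ListAction using (sum)
open import Algebra.Properties.CommutativeSemigroup +-commutativeSemigroup using (xy∙z≈xz∙y; interchange)
open import Data.Nat.ListAction.Properties using (sum-↭; sum-++)
open import Data.List using (List; []; _∷_; length; map; filter; upTo; applyUpTo; reverse; _++_; [_]; _∷ʳ_)
open import Data.List.Properties
  using (length-map; length-upTo; length-++; upTo-∷ʳ; map-++; map-cong-local; map-upTo; map-applyUpTo;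
         filter-all; filter-accept; filter-reject; unfold-reverse)
open import Data.List.Relation.Unary.All as All using (All; []; _∷_)
import Data.List.Relation.Unary.All.Properties as All
open import Data.List.Relation.Unary.Any using (here; there)
open import Data.List.Relation.Unary.Linked as Linked using (Linked; []; [-]; _∷_)
open import Data.List.Relation.Unary.Linked.Properties using (Linked⇒AllPairs; Linked⇒All)
import Data.List.Relation.Unary.AllPairs as AllPairs
open import Data.List.Relation.Unary.Unique.Propositional using (Unique; []; _∷_)
import Data.List.Relation.Unary.Unique.Propositional.Properties as Unique
open import Data.List.Relation.Binary.Permutation.Propositional using (_↭_)
open import Data.List.Relation.Binary.Permutation.Propositional.Properties using (shift; ↭-length)
open import Data.List.Relation.Binary.BagAndSetEquality using (_∼[_]_; set; ∼bag⇒↭)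
open import Data.List.Membership.Propositional using (_∈_; _∉_)
open import Data.List.Membership.Propositional.Properties
  using (∈-∃++; ∈-++⁻; ∈-++⁺ˡ; ∈-++⁺ʳ; ∈-map⁺; ∈-map⁻; ∈-upTo⁺; ∈-upTo⁻; ∈-filter⁺; ∈-filter⁻)
open import Data.List.Membership.Propositional.Properties.WithK using (unique∧set⇒bag)
open import Data.Product as Product using (_×_; _,_; proj₁; proj₂; ∃)
open import Data.Sum as Sum using (_⊎_; inj₁; inj₂)
open import Data.Empty using (⊥; ⊥-elim)
open import Function.Base using (_∘_)
open import Function.Bundles using (_⇔_; mk⇔; Equivalence)
open import Relation.Nullary using (¬_; yes; no; ¬?)
open import Relation.Unary using (Decidable)
open import Data.List.Membership.DecPropositional _≟_ using (_∈?_; _∉?_)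
open import Relation.Binary.Definitions using (tri<; tri≈; tri>)
open import Relation.Binary.PropositionalEquality hiding ([_])

unique∧set⇒↭ : ∀ {xs ys : List ℕ} → Unique xs → Unique ys → xs ∼[ set ] ys → xs ↭ ys
unique∧set⇒↭ ux uy xs∼ys = ∼bag⇒↭ (unique∧set⇒bag ux uy xs∼ys)

sum-mono-⊆ : ∀ {xs ys} → Unique xs → (∀ {x} → x ∈ xs → x ∈ ys) → sum xs ≤ sum ys
sum-mono-⊆ {[]} _ _ = z≤n
sum-mono-⊆ {x ∷ xs} {ys} (x∉xs ∷ uxs) xs⊆ys with as , bs , refl ← ∈-∃++ (xs⊆ys (here refl)) =
  begin
    x + sum xs            ≤⟨ +-monoʳ-≤ x (sum-mono-⊆ uxs xs⊆as++bs) ⟩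
    x + sum (as ++ bs)    ≡⟨ sum-↭ (shift x as bs) ⟨
    sum (as ++ x ∷ bs)    ∎
  where
  open ≤-Reasoning
  xs⊆as++bs : ∀ {z} → z ∈ xs → z ∈ as ++ bs
  xs⊆as++bs {z} z∈xs with ∈-++⁻ as (xs⊆ys (there z∈xs))
  ... | inj₁ z∈as          = ∈-++⁺ˡ z∈as
  ... | inj₂ (here refl)   = ⊥-elim (All.lookup x∉xs z∈xs refl)
  ... | inj₂ (there z∈bs)  = ∈-++⁺ʳ as z∈bs

sum-mono-pair : ∀ {x y xs} → x ∈ xs → y ∈ xs → x ≢ y → x + y ≤ sum xs
sum-mono-pair {x} {y} {xs} x∈xs y∈xs x≢y =
  subst (_≤ sum xs) (cong (x +_) (+-identityʳ y)) (sum-mono-⊆ ((x≢y ∷ []) ∷ [] ∷ []) [x,y]⊆xs)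
  where
  [x,y]⊆xs : ∀ {z} → z ∈ x ∷ y ∷ [] → z ∈ xs
  [x,y]⊆xs (here refl)         = x∈xs
  [x,y]⊆xs (there (here refl)) = y∈xs

part<sum : ∀ {x y xs} → All (1 ≤_) xs → x ∈ xs → y ∈ xs → x ≢ y → x < sum xs
part<sum xs>0 x∈ y∈ x≢y = <-≤-trans (m<m+n _ (All.lookup xs>0 y∈)) (sum-mono-pair x∈ y∈ x≢y)

sum-map-mono : ∀ {f : ℕ → ℕ} xs → All (λ x → x ≤ f x) xs → sum xs ≤ sum (map f xs)
sum-map-mono []       []         = z≤n
sum-map-mono (x ∷ xs) (x≤ ∷ xs≤) = +-mono-≤ x≤ (sum-map-mono xs xs≤)

sum-map-+ : ∀ r xs → All (_≤ r) xs → sum (map (r +_) xs) ≡ sum (map (r ∸_) xs) + (sum xs + sum xs)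
sum-map-+ r []       []           = refl
sum-map-+ r (x ∷ xs) (x≤r ∷ xs≤r) = begin
  r + x + sum (map (r +_) xs)                       ≡⟨ cong₂ _+_ r+x≡ (sum-map-+ r xs xs≤r) ⟩
  (r ∸ x + (x + x)) + (S∸ + (S + S))                ≡⟨ interchange (r ∸ x) (x + x) S∸ (S + S) ⟩
  (r ∸ x + S∸) + ((x + x) + (S + S))                ≡⟨ cong ((r ∸ x + S∸) +_) (interchange x x S S) ⟩
  (r ∸ x + S∸) + ((x + S) + (x + S))                ∎
  where
  open ≡-Reasoning
  S S∸ : ℕ
  S = sum xs
  S∸ = sum (map (r ∸_) xs)
  r+x≡ : r + x ≡ r ∸ x + (x + x)
  r+x≡ = trans (cong (_+ x) (sym (m∸n+n≡m x≤r))) (+-assoc (r ∸ x) x x)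

Unique-map⁺-on : ∀ {P : ℕ → Set} {f : ℕ → ℕ} {xs} → (∀ {x y} → P x → P y → f x ≡ f y → x ≡ y) →
  All P xs → Unique xs → Unique (map f xs)
Unique-map⁺-on inj []         []         = []
Unique-map⁺-on inj (px ∷ pxs) (x∉ ∷ uxs) =
  All.map⁺ (All.zipWith (λ (py , x≢y) fx≡fy → x≢y (inj px py fx≡fy)) (pxs , x∉)) ∷ Unique-map⁺-on inj pxs uxs

length-filter-∁+length-filter : ∀ {P : ℕ → Set} (P? : Decidable P) xs →
  length (filter (¬? ∘ P?) xs) + length (filter P? xs) ≡ length xs
length-filter-∁+length-filter P? []       = refl
length-filter-∁+length-filter P? (x ∷ xs) with P? x
... | yes _ = trans (+-suc _ _) (cong suc (length-filter-∁+length-filter P? xs))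
... | no  _ = cong suc (length-filter-∁+length-filter P? xs)

Linked<⇒Unique : ∀ {xs} → Linked _<_ xs → Unique xs
Linked<⇒Unique l = AllPairs.map <⇒≢ (Linked⇒AllPairs <-trans l)

Linked-∷ʳ : ∀ {R : ℕ → ℕ → Set} {xs z} → Linked R xs → All (λ x → R x z) xs → Linked R (xs ∷ʳ z)
Linked-∷ʳ []        []        = [-]
Linked-∷ʳ [-]       (r ∷ [])  = r ∷ [-]
Linked-∷ʳ (r ∷ l)   (_ ∷ rs)  = r ∷ Linked-∷ʳ l rs

largest-∈ : ∀ {x xs} → largest (x ∷ xs) ∈ x ∷ xs
largest-∈ {xs = []}     = here refl
largest-∈ {xs = y ∷ xs} = there largest-∈

∈⇒largest∈ : ∀ {x xs} → x ∈ xs → largest xs ∈ xs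
∈⇒largest∈ {xs = _ ∷ _} _ = largest-∈

≤largest : ∀ {x xs} → Linked _<_ xs → x ∈ xs → x ≤ largest xs
≤largest {xs = _ ∷ []}     [-]       (here refl) = ≤-refl
≤largest {xs = _ ∷ y ∷ ys} (x<y ∷ l) (here refl) = <⇒≤ (<-≤-trans x<y (≤largest l (here refl)))
≤largest {xs = _ ∷ y ∷ ys} (_ ∷ l)   (there x∈) = ≤largest l x∈

at-∈ : ∀ {i} xs → i < length xs → at xs (suc i) ∈ xs
at-∈ {zero}  (x ∷ xs) _         = here refl
at-∈ {suc i} (x ∷ xs) (s≤s i<n) = there (at-∈ xs i<n)

∈⇒at : ∀ {x xs} → x ∈ xs → ∃ λ i → i < length xs × at xs (suc i) ≡ x
∈⇒at (here refl) = zero , s≤s z≤n , refl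
∈⇒at (there x∈xs) with i , i<n , eq ← ∈⇒at x∈xs = suc i , s≤s i<n , eq

∈-fromTo⁺ : ∀ {v m} → 1 ≤ v → v ≤ m → v ∈ fromTo 1 m
∈-fromTo⁺ {suc v} _ v≤m = ∈-map⁺ suc (∈-upTo⁺ v≤m)

∈-fromTo⁻ : ∀ {v m} → v ∈ fromTo 1 m → 1 ≤ v × v ≤ m
∈-fromTo⁻ v∈ with u , u∈ , refl ← ∈-map⁻ suc v∈ = s≤s z≤n , ∈-upTo⁻ u∈

unique-fromTo : ∀ m → Unique (fromTo 1 m)
unique-fromTo m = Unique.map⁺ suc-injective (Unique.upTo⁺ m)

length-fromTo : ∀ m → length (fromTo 1 m) ≡ m
length-fromTo m = trans (length-map suc (upTo m)) (length-upTo m)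

T-suc : ∀ m → T (suc m) ≡ T m + suc m
T-suc m = begin
  (suc m * suc (suc m)) / 2       ≡⟨ cong (_/ 2) (m+1*[m+2]≡m*[m+1]+[m+1]*2 m) ⟩
  (m * suc m + suc m * 2) / 2     ≡⟨ +-distrib-/-∣ʳ (m * suc m) (divides-refl (suc m)) ⟩
  T m + suc m * 2 / 2             ≡⟨ cong (T m +_) (m*n/n≡m (suc m) 2) ⟩
  T m + suc m                     ∎
  where
  open ≡-Reasoning
  m+1*[m+2]≡m*[m+1]+[m+1]*2 : ∀ m → suc m * suc (suc m) ≡ m * suc m + suc m * 2
  m+1*[m+2]≡m*[m+1]+[m+1]*2 = solve-∀

sum-fromTo : ∀ m → sum (fromTo 1 m) ≡ T m
sum-fromTo zero    = refl
sum-fromTo (suc m) = begin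
  sum (map suc (upTo (suc m)))          ≡⟨ cong (sum ∘ map suc) (upTo-∷ʳ m) ⟨
  sum (map suc (upTo m ∷ʳ m))           ≡⟨ cong sum (map-++ suc (upTo m) [ m ]) ⟩
  sum (fromTo 1 m ++ [ suc m ])         ≡⟨ sum-++ (fromTo 1 m) [ suc m ] ⟩
  sum (fromTo 1 m) + (suc m + 0)        ≡⟨ cong₂ _+_ (sum-fromTo m) (+-identityʳ (suc m)) ⟩
  T m + suc m                           ≡⟨ T-suc m ⟨
  T (suc m)                             ∎
  where open ≡-Reasoning

T₂≡T+r+2k : ∀ {n r k} → n ∸ 2 ≡ r → 2 * k ≤ r → T₂ n (n ∸ 2 * k + 1) ≡ T r + r + 2 * k
T₂≡T+r+2k {zero}        {k = zero} refl _ = refl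
T₂≡T+r+2k {suc zero}    {k = zero} refl _ = refl
T₂≡T+r+2k {suc (suc r)} {_} {k} refl 2k≤r = begin
  T (2 + r) ∸ (2 + r ∸ 2 * k + 1)          ≡⟨ cong₂ _∸_ T[2+r]≡ 2+r∸2k+1≡3+x ⟩
  T r + r + 2 * k + (3 + x) ∸ (3 + x)      ≡⟨ m+n∸n≡m (T r + r + 2 * k) (3 + x) ⟩
  T r + r + 2 * k                          ∎
  where
  open ≡-Reasoning
  x : ℕ
  x = r ∸ 2 * k
  2+r∸2k+1≡3+x : 2 + r ∸ 2 * k + 1 ≡ 3 + x
  2+r∸2k+1≡3+x = trans (cong (_+ 1) (+-∸-assoc 2 2k≤r)) (+-comm (2 + x) 1)
  T[2+r]≡ : T (2 + r) ≡ T r + r + 2 * k + (3 + x)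
  T[2+r]≡ = begin
    T (2 + r)                       ≡⟨ T-suc (suc r) ⟩
    T (suc r) + (2 + r)             ≡⟨ cong (_+ (2 + r)) (T-suc r) ⟩
    T r + suc r + (2 + r)           ≡⟨ cong (λ z → T r + suc r + (2 + z)) (m∸n+n≡m 2k≤r) ⟨
    T r + suc r + (2 + (x + 2 * k)) ≡⟨ rearrange (T r) r x (2 * k) ⟩
    T r + r + 2 * k + (3 + x)       ∎
    where
    rearrange : ∀ t r x y → t + suc r + (2 + (x + y)) ≡ t + r + y + (3 + x)
    rearrange = solve-∀

[m+m]/2≡m : ∀ m → (m + m) / 2 ≡ m
[m+m]/2≡m m = trans (cong (_/ 2) (trans (cong (m +_) (sym (+-identityʳ m))) (*-comm 2 m))) (m*n/n≡m m 2)

crossing : ∀ (f : ℕ → ℕ) {w} d → 0 < d → w < f 0 → (∀ {p} → p < d → f p ≢ w) →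
  ∃ λ y → y < d × w < f y × (suc y ≡ d ⊎ (suc y < d × f (suc y) < w))
crossing f {w} (suc d) _ = go f d
  where
  go : ∀ (g : ℕ → ℕ) d → w < g 0 → (∀ {p} → p < suc d → g p ≢ w) →
    ∃ λ y → y < suc d × w < g y × (suc y ≡ suc d ⊎ (suc y < suc d × g (suc y) < w))
  go g zero    w<g0 _ = 0 , s≤s z≤n , w<g0 , inj₁ refl
  go g (suc d) w<g0 g≢w with <-cmp (g 1) w
  ... | tri< g1<w _ _ = 0 , s≤s z≤n , w<g0 , inj₂ (s≤s (s≤s z≤n) , g1<w)
  ... | tri≈ _ g1≡w _ = ⊥-elim (g≢w (s≤s (s≤s z≤n)) g1≡w)
  ... | tri> _ _ w<g1 with y , y≤d , w<gy , side ← go (g ∘ suc) d w<g1 (λ p≤d → g≢w (s≤s p≤d)) =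
    suc y , s≤s y≤d , w<gy , Sum.map (cong suc) (Product.map₁ s≤s) side

-- Unrefinable partitions

part<total : ∀ {k η e} → DistinctPartition k η → e ∈ η → e < k
part<total {η = _ ∷ []}     (_ , _ , s≤s () , _) _
part<total {η = a ∷ b ∷ _} {e} (η>0 , a<b ∷ _ , _ , refl) e∈ with e ≟ a
... | yes refl = part<sum η>0 e∈ (there (here refl)) (<⇒≢ a<b)
... | no  e≢a  = part<sum η>0 e∈ (here refl) e≢a

total>0 : ∀ {k η} → DistinctPartition k η → 0 < k
total>0 {η = e ∷ _} (e>0 ∷ _ , _ , _ , refl) = <-≤-trans e>0 (m≤m+n e _)

numMissing+length≡largest : ∀ {p} → All (1 ≤_) p → Linked _<_ p → numMissing p + length p ≡ largest p
numMissing+length≡largest {p} p>0 p↑ = begin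
  length absent + length p                 ≡⟨ cong (length absent +_) (↭-length present↭p) ⟨
  length absent + length present           ≡⟨ length-filter-∁+length-filter (_∈? p) candidates ⟩
  length candidates                        ≡⟨ length-fromTo (largest p) ⟩
  largest p                                ∎
  where
  open ≡-Reasoning
  candidates absent present : List ℕ
  candidates = fromTo 1 (largest p)
  absent     = filter (_∉? p) candidates
  present    = filter (_∈? p) candidates
  present↭p : present ↭ p
  present↭p = unique∧set⇒↭ (Unique.filter⁺ (_∈? p) (unique-fromTo (largest p))) (Linked<⇒Unique p↑)
    (mk⇔ (λ v∈ → proj₂ (∈-filter⁻ (_∈? p) {xs = candidates} v∈))
         (λ v∈ → ∈-filter⁺ (_∈? p) {xs = candidates}
                   (∈-fromTo⁺ (All.lookup p>0 v∈) (≤largest p↑ v∈)) v∈))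

module _ {μ : List ℕ} (unref : Unrefinable μ) (t∈μ : largest μ ∈ μ) where

  private
    t : ℕ
    t = largest μ

  unrefinable⇒∈⊎∈ : ∀ {x} → 1 ≤ x → x + x < t → x ∈ μ ⊎ t ∸ x ∈ μ
  unrefinable⇒∈⊎∈ {x} 1≤x 2x<t with x ∈? μ | (t ∸ x) ∈? μ
  ... | yes x∈μ | _         = inj₁ x∈μ
  ... | no  _   | yes t-x∈μ = inj₂ t-x∈μ
  ... | no  x∉μ | no  t-x∉μ =
    ⊥-elim (unref (x , t ∸ x , (1≤x , x≤t , x∉μ) , (1≤t-x , m∸n≤m t x , t-x∉μ) , x≢t-x ,
                   subst (_∈ μ) (sym (m+[n∸m]≡n x≤t)) t∈μ))
    where
    x≤t : x ≤ t
    x≤t = ≤-trans (m≤m+n x x) (<⇒≤ 2x<t)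
    x<t-x : x < t ∸ x
    x<t-x = +-cancelʳ-< x x (t ∸ x) (subst (x + x <_) (sym (m∸n+n≡m x≤t)) 2x<t)
    1≤t-x : 1 ≤ t ∸ x
    1≤t-x = ≤-trans 1≤x (<⇒≤ x<t-x)
    x≢t-x : x ≢ t ∸ x
    x≢t-x = <⇒≢ x<t-x

  partner : ℕ → ℕ
  partner x with x ∈? μ
  ... | yes _ = x
  ... | no  _ = t ∸ x

  module _ {R : ℕ} (2R<t : R + R < t) where

    private
      InRange : ℕ → Set
      InRange x = 1 ≤ x × x ≤ R

      ≤t : ∀ {x} → x ≤ R → x ≤ t
      ≤t x≤R = ≤-trans x≤R (≤-trans (m≤m+n R R) (<⇒≤ 2R<t))

      R<t-x : ∀ {x} → x ≤ R → R < t ∸ x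
      R<t-x {x} x≤R = +-cancelʳ-< x R (t ∸ x) (begin-strict
        R + x        ≤⟨ +-monoʳ-≤ R x≤R ⟩
        R + R        <⟨ 2R<t ⟩
        t            ≡⟨ m∸n+n≡m (≤t x≤R) ⟨
        t ∸ x + x    ∎)
        where open ≤-Reasoning

      2x<t : ∀ {x} → x ≤ R → x + x < t
      2x<t x≤R = ≤-<-trans (+-mono-≤ x≤R x≤R) 2R<t

    partner-∈ : ∀ {x} → InRange x → partner x ∈ μ
    partner-∈ {x} (1≤x , x≤R) with x ∈? μ | unrefinable⇒∈⊎∈ 1≤x (2x<t x≤R)
    ... | yes x∈μ | _          = x∈μ
    ... | no  x∉μ | inj₁ x∈μ   = ⊥-elim (x∉μ x∈μ)
    ... | no  _   | inj₂ t-x∈μ = t-x∈μ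

    x≤partner : ∀ {x} → InRange x → x ≤ partner x
    x≤partner {x} (_ , x≤R) with x ∈? μ
    ... | yes _ = ≤-refl
    ... | no  _ = ≤-trans x≤R (<⇒≤ (R<t-x x≤R))

    partner≢t : ∀ {x} → InRange x → partner x ≢ t
    partner≢t {x} (1≤x , x≤R) with x ∈? μ
    ... | yes _ = <⇒≢ (≤-<-trans x≤R (≤-<-trans (m≤m+n R R) 2R<t))
    ... | no  _ = <⇒≢ (∸-monoʳ-< 1≤x (≤t x≤R))

    partner-injective : ∀ {x y} → InRange x → InRange y → partner x ≡ partner y → x ≡ y
    partner-injective {x} {y} (_ , x≤R) (_ , y≤R) eq with x ∈? μ | y ∈? μ
    ... | yes _ | yes _ = eq
    ... | yes _ | no  _ = ⊥-elim (<⇒≢ (≤-<-trans x≤R (R<t-x y≤R)) eq)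
    ... | no  _ | yes _ = ⊥-elim (<⇒≢ (≤-<-trans y≤R (R<t-x x≤R)) (sym eq))
    ... | no  _ | no  _ = ∸-cancelˡ-≡ (≤t x≤R) (≤t y≤R) eq

    largest+T≤sum : t + T R ≤ sum μ
    largest+T≤sum = begin
      t + T R                               ≡⟨ cong (t +_) (sum-fromTo R) ⟨
      t + sum (fromTo 1 R)                  ≤⟨ +-monoʳ-≤ t (sum-map-mono (fromTo 1 R) (All.map x≤partner inRange)) ⟩
      sum (t ∷ map partner (fromTo 1 R))    ≤⟨ sum-mono-⊆ unique ⊆μ ⟩
      sum μ                                 ∎
      where
      open ≤-Reasoning
      inRange : All InRange (fromTo 1 R)
      inRange = All.tabulate ∈-fromTo⁻
      unique : Unique (t ∷ map partner (fromTo 1 R))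
      unique = All.map⁺ (All.map (λ x∈R t≡px → partner≢t x∈R (sym t≡px)) inRange)
             ∷ Unique-map⁺-on partner-injective inRange (unique-fromTo R)
      ⊆μ : ∀ {z} → z ∈ t ∷ map partner (fromTo 1 R) → z ∈ μ
      ⊆μ (here refl) = t∈μ
      ⊆μ (there z∈)  with x , x∈ , refl ← ∈-map⁻ partner z∈ = partner-∈ (∈-fromTo⁻ x∈)

unrefinable⇒largest≤ : ∀ {μ} R → Unrefinable μ → sum μ ≤ T R + (R + R) → largest μ ≤ R + R
unrefinable⇒largest≤ {[]}        R _     _    = z≤n
unrefinable⇒largest≤ {μ@(_ ∷ _)} R unref sum≤ with largest μ ≤? R + R
... | yes t≤2R = t≤2R
... | no  t≰2R = ⊥-elim (<-irrefl refl (begin-strict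
      T R + (R + R)      <⟨ +-monoʳ-< (T R) (≰⇒> t≰2R) ⟩
      T R + largest μ    ≡⟨ +-comm (T R) (largest μ) ⟩
      largest μ + T R    ≤⟨ largest+T≤sum unref largest-∈ {R = R} (≰⇒> t≰2R) ⟩
      sum μ              ≤⟨ sum≤ ⟩
      T R + (R + R)      ∎))
  where open ≤-Reasoning

-- Young diagrams and beta-numbers

rowLen-antitone : ∀ {Y p p′} → Linked _≥_ Y → p ≤ p′ → rowLen Y (suc p′) ≤ rowLen Y (suc p)
rowLen-antitone {[]}    _ _ = z≤n
rowLen-antitone {y ∷ Y} {zero} {zero} _ _ = ≤-refl
rowLen-antitone {y ∷ []} {zero} {suc p′} _ _ = z≤n
rowLen-antitone {y ∷ y′ ∷ Y} {zero} {suc p′} (y≥y′ ∷ l) _ =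
  ≤-trans (rowLen-antitone {p′ = p′} l z≤n) y≥y′
rowLen-antitone {y ∷ Y} {suc p} {suc p′} l (s≤s p≤p′) = rowLen-antitone (Linked.tail l) p≤p′

colLen-1 : ∀ {Y} → All (1 ≤_) Y → colLen Y 1 ≡ length Y
colLen-1 Y>0 = cong length (filter-all (1 ≤?_) Y>0)

rowLen>0⇒<length : ∀ Y p → 1 ≤ rowLen Y (suc p) → p < length Y
rowLen>0⇒<length (y ∷ Y) zero    _   = s≤s z≤n
rowLen>0⇒<length (y ∷ Y) (suc p) r>0 = s≤s (rowLen>0⇒<length Y p r>0)

<length⇒rowLen>0 : ∀ {Y p} → All (1 ≤_) Y → p < length Y → 1 ≤ rowLen Y (suc p)
<length⇒rowLen>0 {p = zero}  (y>0 ∷ _)  _         = y>0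
<length⇒rowLen>0 {p = suc p} (_ ∷ Y>0)  (s≤s p<n) = <length⇒rowLen>0 Y>0 p<n

colLen-∷⁺ : ∀ {y Y j} → j ≤ y → colLen (y ∷ Y) j ≡ suc (colLen Y j)
colLen-∷⁺ {j = j} j≤y = cong length (filter-accept (j ≤?_) j≤y)

≤rowLen⇒≤colLen : ∀ {Y p q} → Linked _≥_ Y → suc q ≤ rowLen Y (suc p) → suc p ≤ colLen Y (suc q)
≤rowLen⇒≤colLen {y ∷ Y} {p} l q<row
  rewrite colLen-∷⁺ {Y = Y} (≤-trans q<row (rowLen-antitone {p′ = p} l z≤n)) with p
... | zero  = s≤s z≤n
... | suc p = s≤s (≤rowLen⇒≤colLen (Linked.tail l) q<row)

≤colLen⇒≤rowLen : ∀ {Y p q} → Linked _≥_ Y → suc p ≤ colLen Y (suc q) → suc q ≤ rowLen Y (suc p)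
≤colLen⇒≤rowLen {y ∷ Y} {p} {q} l p<col with suc q ≤? y
... | no  q≮y = ⊥-elim (q≮y (≤-trans below (rowLen-antitone {p′ = suc p} l z≤n)))
  where
  below : suc q ≤ rowLen Y (suc p)
  below = ≤colLen⇒≤rowLen (Linked.tail l) (subst (suc p ≤_) (cong length (filter-reject (suc q ≤?_) q≮y)) p<col)
... | yes q<y with p | subst (suc p ≤_) (colLen-∷⁺ {Y = Y} q<y) p<col
...   | zero  | _           = q<y
...   | suc p | s≤s p<col′ = ≤colLen⇒≤rowLen (Linked.tail l) p<col′

betaNumbers : List ℕ → List ℕ
betaNumbers []      = []
betaNumbers (y ∷ Y) = betaNumbers Y ∷ʳ (y + length Y)

betaNumbers≡applyUpTo : ∀ Y →
  betaNumbers Y ≡ reverse (applyUpTo (λ p → rowLen Y (suc p) + (length Y ∸ suc p)) (length Y))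
betaNumbers≡applyUpTo []      = refl
betaNumbers≡applyUpTo (y ∷ Y) = begin
  betaNumbers Y ∷ʳ (y + length Y)                     ≡⟨ cong (_∷ʳ (y + length Y)) (betaNumbers≡applyUpTo Y) ⟩
  reverse (applyUpTo row (length Y)) ∷ʳ (y + length Y)    ≡⟨ unfold-reverse (y + length Y) (applyUpTo row (length Y)) ⟨
  reverse ((y + length Y) ∷ applyUpTo row (length Y))     ∎
  where
  open ≡-Reasoning
  row : ℕ → ℕ
  row p = rowLen Y (suc p) + (length Y ∸ suc p)

hook-col₁ : ∀ {Y i} → All (1 ≤_) Y → 1 ≤ rowLen Y i → hook Y i 1 ≡ rowLen Y i + (length Y ∸ i)
hook-col₁ {Y} {i} Y>0 row>0 = begin
  (rowLen Y i ∸ 1) + (colLen Y 1 ∸ i) + 1    ≡⟨ cong (λ c → (rowLen Y i ∸ 1) + (c ∸ i) + 1) (colLen-1 Y>0) ⟩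
  (rowLen Y i ∸ 1) + (length Y ∸ i) + 1      ≡⟨ +-comm _ 1 ⟩
  1 + ((rowLen Y i ∸ 1) + (length Y ∸ i))    ≡⟨ +-assoc 1 (rowLen Y i ∸ 1) _ ⟨
  (1 + (rowLen Y i ∸ 1)) + (length Y ∸ i)    ≡⟨ cong (_+ (length Y ∸ i)) (m+[n∸m]≡n row>0) ⟩
  rowLen Y i + (length Y ∸ i)                ∎
  where open ≡-Reasoning

firstColHooks≡betaNumbers : ∀ {Y} → All (1 ≤_) Y → firstColHooks Y ≡ betaNumbers Y
firstColHooks≡betaNumbers {Y} Y>0 = begin
  reverse (map (λ i → hook Y i 1) (map suc (upTo r)))                   ≡⟨ cong reverse (map-cong-local hooks) ⟩
  reverse (map (λ i → rowLen Y i + (r ∸ i)) (map suc (upTo r)))         ≡⟨ cong (reverse ∘ map _) (map-upTo suc r) ⟩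
  reverse (map (λ i → rowLen Y i + (r ∸ i)) (applyUpTo suc r))          ≡⟨ cong reverse (map-applyUpTo suc _ r) ⟩
  reverse (applyUpTo (λ p → rowLen Y (suc p) + (r ∸ suc p)) r)         ≡⟨ betaNumbers≡applyUpTo Y ⟨
  betaNumbers Y                                                         ∎
  where
  open ≡-Reasoning
  r : ℕ
  r = length Y
  hooks : All (λ i → hook Y i 1 ≡ rowLen Y i + (r ∸ i)) (map suc (upTo r))
  hooks = All.map⁺ (All.tabulate λ p∈ → hook-col₁ Y>0 (<length⇒rowLen>0 Y>0 (∈-upTo⁻ p∈)))

length-betaNumbers : ∀ Y → length (betaNumbers Y) ≡ length Y
length-betaNumbers []      = refl
length-betaNumbers (y ∷ Y) = trans (length-++ (betaNumbers Y)) (trans (+-comm _ 1) (cong suc (length-betaNumbers Y)))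

betaNumbers-positive : ∀ {Y} → All (1 ≤_) Y → All (1 ≤_) (betaNumbers Y)
betaNumbers-positive []          = []
betaNumbers-positive (y>0 ∷ Y>0) = All.++⁺ (betaNumbers-positive Y>0) (≤-trans y>0 (m≤m+n _ _) ∷ [])

betaNumbers-bounded : ∀ {h Y} → All (_≤ h) Y → All (_< h + length Y) (betaNumbers Y)
betaNumbers-bounded             []          = []
betaNumbers-bounded {h} {y ∷ Y} (y≤h ∷ Y≤h) =
  All.++⁺ (All.map (λ b< → <-≤-trans b< (+-monoʳ-≤ h (n≤1+n (length Y)))) (betaNumbers-bounded Y≤h))
          (subst (y + length Y <_) (sym (+-suc h (length Y))) (s≤s (+-monoˡ-≤ (length Y) y≤h)) ∷ [])

rows-≤-first : ∀ {y Y} → Linked _≥_ (y ∷ Y) → All (_≤ y) Y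
rows-≤-first [-]       = []
rows-≤-first (y≥ ∷ l)  = Linked⇒All (λ a≥b b≥c → ≤-trans b≥c a≥b) y≥ l

betaNumbers-increasing : ∀ {Y} → Linked _≥_ Y → Linked _<_ (betaNumbers Y)
betaNumbers-increasing {[]}    _ = []
betaNumbers-increasing {y ∷ Y} l =
  Linked-∷ʳ (betaNumbers-increasing (Linked.tail l)) (betaNumbers-bounded (rows-≤-first l))

∈-betaNumbers⁻ : ∀ {v} Y → v ∈ betaNumbers Y →
  ∃ λ p → p < length Y × v ≡ rowLen Y (suc p) + (length Y ∸ suc p)
∈-betaNumbers⁻ (y ∷ Y) v∈ with ∈-++⁻ (betaNumbers Y) v∈
... | inj₂ (here refl) = zero , s≤s z≤n , refl
... | inj₁ v∈′ with p , p<n , refl ← ∈-betaNumbers⁻ Y v∈′ = suc p , s≤s p<n , refl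

∈-betaNumbers⁺ : ∀ {p} Y → p < length Y → rowLen Y (suc p) + (length Y ∸ suc p) ∈ betaNumbers Y
∈-betaNumbers⁺ {zero}  (y ∷ Y) _         = ∈-++⁺ʳ (betaNumbers Y) (here refl)
∈-betaNumbers⁺ {suc p} (y ∷ Y) (s≤s p<n) = ∈-++⁺ˡ (∈-betaNumbers⁺ Y p<n)

-- Frobenius description of the beta-numbers

module Frobenius {Y : List ℕ} (young : YoungDiagram Y) (d : ℕ)
  (diagonal : ∀ {p} → p < d → suc p ≤ rowLen Y (suc p))
  (offDiagonal : rowLen Y (suc d) ≤ d) where

  private
    r : ℕ
    r = length Y
    Y>0 : All (1 ≤_) Y
    Y>0 = proj₁ young
    Y↓ : Linked _≥_ Y
    Y↓ = proj₂ young

  α β : ℕ → ℕ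
  α p = arm Y (suc p) (suc p)
  β p = leg Y (suc p) (suc p)

  rowLen≡ : ∀ {p} → p < d → rowLen Y (suc p) ≡ suc p + α p
  rowLen≡ p<d = sym (m+[n∸m]≡n (diagonal p<d))

  colLen≡ : ∀ {p} → p < d → colLen Y (suc p) ≡ suc p + β p
  colLen≡ p<d = sym (m+[n∸m]≡n (≤rowLen⇒≤colLen Y↓ (diagonal p<d)))

  row<r : ∀ {p} → 1 ≤ rowLen Y (suc p) → p < r
  row<r {p} = rowLen>0⇒<length Y p

  hook-of-row : ∀ {p a} → p < r → rowLen Y (suc p) ≡ suc p + a → rowLen Y (suc p) + (r ∸ suc p) ≡ r + a
  hook-of-row {p} {a} p<r row≡ = begin
    rowLen Y (suc p) + (r ∸ suc p)   ≡⟨ cong (_+ (r ∸ suc p)) row≡ ⟩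
    suc p + a + (r ∸ suc p)          ≡⟨ +-comm (suc p + a) _ ⟩
    (r ∸ suc p) + (suc p + a)        ≡⟨ +-assoc (r ∸ suc p) (suc p) a ⟨
    (r ∸ suc p) + suc p + a          ≡⟨ cong (_+ a) (m∸n+n≡m p<r) ⟩
    r + a                            ∎
    where open ≡-Reasoning

  diagonalHook∈ : ∀ {p} → p < d → r + α p ∈ betaNumbers Y
  diagonalHook∈ {p} p<d = subst (_∈ betaNumbers Y) (hook-of-row p<r (rowLen≡ p<d)) (∈-betaNumbers⁺ Y p<r)
    where
    p<r : p < r
    p<r = row<r (≤-trans (s≤s z≤n) (diagonal p<d))

  -- v = r − 1 − β q, stated without truncated subtraction
  LegGap : ℕ → Set
  LegGap v = ∃ λ q → q < d × v + suc (β q) ≡ r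

  private
    ρ : ℕ → ℕ
    ρ p = rowLen Y (suc p)

  belowDiagonal : ∀ {p} → d ≤ p → ρ p ≤ d
  belowDiagonal d≤p = ≤-trans (rowLen-antitone Y↓ d≤p) offDiagonal

  shortRow : ∀ {p} → d ≤ p → ρ p ≤ p
  shortRow d≤p = ≤-trans (belowDiagonal d≤p) d≤p

  shortRow-hook< : ∀ {p} → p < r → ρ p ≤ p → ρ p + (r ∸ suc p) < r
  shortRow-hook< {p} p<r ρ≤p = subst (ρ p + (r ∸ suc p) <_) (m+[n∸m]≡n p<r) (+-monoˡ-< (r ∸ suc p) (s≤s ρ≤p))

  shortRow-endpoint≢ : ∀ {p q} → q < d → ρ p ≤ p → ρ p + suc (β q) ≢ suc p
  shortRow-endpoint≢ {p} {q} q<d ρ≤p ρ+legGap with suc q ≤? ρ p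
  ... | yes q<ρ = <-irrefl refl (begin-strict
        suc p              ≤⟨ ≤rowLen⇒≤colLen Y↓ q<ρ ⟩
        colLen Y (suc q)   ≡⟨ colLen≡ q<d ⟩
        suc q + β q        ≤⟨ +-monoˡ-≤ (β q) q<ρ ⟩
        ρ p + β q          <⟨ +-monoʳ-< (ρ p) (n<1+n (β q)) ⟩
        ρ p + suc (β q)    ≡⟨ ρ+legGap ⟩
        suc p              ∎)
    where open ≤-Reasoning
  ... | no  q≮ρ = <-irrefl refl (begin-strict
        suc q + β q        ≡⟨ colLen≡ q<d ⟨
        colLen Y (suc q)   <⟨ ≰⇒> (q≮ρ ∘ ≤colLen⇒≤rowLen Y↓) ⟩
        suc p              ≡⟨ ρ+legGap ⟨
        ρ p + suc (β q)    ≤⟨ +-monoˡ-≤ (suc (β q)) (≤-pred (≰⇒> q≮ρ)) ⟩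
        q + suc (β q)      ≡⟨ +-suc q (β q) ⟩
        suc q + β q        ∎)
    where open ≤-Reasoning

  shortRow-¬LegGap : ∀ {p} → p < r → ρ p ≤ p → ¬ LegGap (ρ p + (r ∸ suc p))
  shortRow-¬LegGap {p} p<r ρ≤p (q , q<d , gap) = shortRow-endpoint≢ q<d ρ≤p (+-cancelʳ-≡ (r ∸ suc p) _ _ (begin
    ρ p + suc (β q) + (r ∸ suc p)      ≡⟨ xy∙z≈xz∙y (ρ p) (suc (β q)) (r ∸ suc p) ⟩
    ρ p + (r ∸ suc p) + suc (β q)      ≡⟨ gap ⟩
    r                                  ≡⟨ m+[n∸m]≡n p<r ⟨
    suc p + (r ∸ suc p)                ∎))
    where open ≡-Reasoning

  ∈-betaNumbers⇒ : ∀ {v} → v ∈ betaNumbers Y → (∃ λ p → p < d × v ≡ r + α p) ⊎ (v < r × ¬ LegGap v)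
  ∈-betaNumbers⇒ v∈ with p , p<r , refl ← ∈-betaNumbers⁻ Y v∈ with p <? d
  ... | yes p<d = inj₁ (p , p<d , hook-of-row p<r (rowLen≡ p<d))
  ... | no  p≮d = inj₂ (shortRow-hook< p<r ρ≤p , shortRow-¬LegGap p<r ρ≤p)
    where
    ρ≤p : ρ p ≤ p
    ρ≤p = shortRow (≮⇒≥ p≮d)

  d>0 : 0 < r → 0 < d
  d>0 r>0 = n≢0⇒n>0 λ d≡0 →
    <⇒≱ (<length⇒rowLen>0 Y>0 r>0) (subst (λ e → rowLen Y (suc e) ≤ e) d≡0 offDiagonal)

  crossingRow : ∀ {w y} → 1 ≤ w → y < d → w ≤ β y → (suc y ≡ d ⊎ (suc y < d × suc (β (suc y)) < w)) →
    ρ (w + y) ≡ suc y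
  crossingRow {w} {y} w>0 y<d w≤βy side = ≤-antisym (upper side) lower
    where
    open ≤-Reasoning
    lower : suc y ≤ ρ (w + y)
    lower = ≤colLen⇒≤rowLen Y↓ (begin
      suc (w + y)        ≤⟨ s≤s (+-monoˡ-≤ y w≤βy) ⟩
      suc (β y + y)      ≡⟨ cong suc (+-comm (β y) y) ⟩
      suc y + β y        ≡⟨ colLen≡ y<d ⟨
      colLen Y (suc y)   ∎)
    upper : (suc y ≡ d ⊎ (suc y < d × suc (β (suc y)) < w)) → ρ (w + y) ≤ suc y
    upper (inj₁ refl)        = belowDiagonal (+-monoˡ-≤ y w>0)
    upper (inj₂ (y+1<d , legs<w)) with suc (suc y) ≤? ρ (w + y)
    ... | no  y+1≮ρ = ≤-pred (≰⇒> y+1≮ρ)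
    ... | yes y+1<ρ = ⊥-elim (<-irrefl refl (begin-strict
      suc (w + y)                   ≤⟨ ≤rowLen⇒≤colLen Y↓ y+1<ρ ⟩
      colLen Y (suc (suc y))        ≡⟨ colLen≡ y+1<d ⟩
      suc (suc y) + β (suc y)       ≡⟨ cong suc (+-suc y (β (suc y))) ⟨
      suc (y + suc (β (suc y)))     <⟨ s≤s (+-monoʳ-< y legs<w) ⟩
      suc (y + w)                   ≡⟨ cong suc (+-comm y w) ⟩
      suc (w + y)                   ∎))

  crossingRow∈ : ∀ {v w y} → v + w ≡ r → 1 ≤ w → y < d → w ≤ β y →
    (suc y ≡ d ⊎ (suc y < d × suc (β (suc y)) < w)) → v ∈ betaNumbers Y
  crossingRow∈ {v} {w} {y} v+w≡r w>0 y<d w≤βy side = subst (_∈ betaNumbers Y) hook≡v (∈-betaNumbers⁺ Y p<r)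
    where
    p : ℕ
    p = w + y
    ρp≡y+1 : ρ p ≡ suc y
    ρp≡y+1 = crossingRow w>0 y<d w≤βy side
    p<r : p < r
    p<r = row<r (subst (1 ≤_) (sym ρp≡y+1) (s≤s z≤n))
    hook≡v : ρ p + (r ∸ suc p) ≡ v
    hook≡v = +-cancelʳ-≡ w _ _ (begin
      ρ p + (r ∸ suc p) + w        ≡⟨ cong (λ x → x + (r ∸ suc p) + w) ρp≡y+1 ⟩
      suc y + (r ∸ suc p) + w      ≡⟨ xy∙z≈xz∙y (suc y) (r ∸ suc p) w ⟩
      suc y + w + (r ∸ suc p)      ≡⟨ cong (λ x → suc x + (r ∸ suc p)) (+-comm y w) ⟩
      suc p + (r ∸ suc p)          ≡⟨ m+[n∸m]≡n p<r ⟩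
      r                            ≡⟨ v+w≡r ⟨
      v + w                        ∎)
      where open ≡-Reasoning

  -- v is the hook of row w + y, where y is the diagonal index at which 1 + β y drops below w = r − v.
  ¬LegGap⇒∈ : ∀ {v} → v < r → ¬ LegGap v → v ∈ betaNumbers Y
  ¬LegGap⇒∈ {v} v<r ¬gap =
    let (y , y<d , w<βy+1 , side) = crossing (suc ∘ β) d d>0′ w<β₀+1 β+1≢w
    in  crossingRow∈ v+w≡r (m<n⇒0<n∸m v<r) y<d (≤-pred w<βy+1) side
    where
    w : ℕ
    w = r ∸ v
    v+w≡r : v + w ≡ r
    v+w≡r = m+[n∸m]≡n (<⇒≤ v<r)
    d>0′ : 0 < d
    d>0′ = d>0 (≤-<-trans z≤n v<r)
    β+1≢w : ∀ {q} → q < d → suc (β q) ≢ w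
    β+1≢w {q} q<d β+1≡w = ¬gap (q , q<d , trans (cong (v +_) β+1≡w) v+w≡r)
    w<β₀+1 : w < suc (β 0)
    w<β₀+1 = ≤∧≢⇒< (subst (w ≤_) (trans (sym (colLen-1 Y>0)) (colLen≡ d>0′)) (m∸n≤m r v))
                    (β+1≢w d>0′ ∘ sym)

-- The partition λ, with r = n − 2

data Part (r : ℕ) (η : List ℕ) (v : ℕ) : Set where
  top     : v ≡ r + r → Part r η v
  shifted : ∀ {e} → e ∈ η → v ≡ r + e → Part r η v
  small   : 1 ≤ v → v < r → r ∸ v ∉ η → Part r η v

module Parts {k r : ℕ} {η : List ℕ} (η∈𝔻 : DistinctPartition k η) (k+k≤r : k + k ≤ r) where

  η<k : ∀ {e} → e ∈ η → e < k
  η<k = part<total η∈𝔻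

  η<r : ∀ {e} → e ∈ η → e < r
  η<r e∈ = <-≤-trans (η<k e∈) (≤-trans (m≤m+n k k) k+k≤r)

  η>0 : ∀ {e} → e ∈ η → 1 ≤ e
  η>0 = All.lookup (proj₁ η∈𝔻)

  η-sum : sum η ≡ k
  η-sum = proj₂ (proj₂ (proj₂ η∈𝔻))

  η-pair : ∀ {e e′} → e ∈ η → e′ ∈ η → e ≢ e′ → e + e′ ≤ k
  η-pair e∈ e′∈ e≢e′ = subst (_ ≤_) η-sum (sum-mono-pair e∈ e′∈ e≢e′)

  k<r : k < r
  k<r = <-≤-trans (m<m+n k (total>0 η∈𝔻)) k+k≤r

  r>0 : 0 < r
  r>0 = ≤-<-trans z≤n k<r

  η-unique : Unique η
  η-unique = Linked<⇒Unique (proj₁ (proj₂ η∈𝔻))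

  MissingShape : ℕ → Set
  MissingShape m = r ≤ m ⊎ ∃ λ e → e ∈ η × m + e ≡ r

  ¬Part⇒ : ∀ {m} → 1 ≤ m → ¬ Part r η m → MissingShape m
  ¬Part⇒ {m} m>0 ¬part with m <? r
  ... | no  m≮r = inj₁ (≮⇒≥ m≮r)
  ... | yes m<r with (r ∸ m) ∈? η
  ...   | yes r-m∈ = inj₂ (r ∸ m , r-m∈ , m+[n∸m]≡n (<⇒≤ m<r))
  ...   | no  r-m∉ = ⊥-elim (¬part (small m>0 m<r r-m∉))

  private
    complement-shift : ∀ {a b e} → a + e ≡ r → a + b ≡ r + r → b ≡ r + e
    complement-shift {a} {b} {e} a+e≡r a+b≡2r = +-cancelˡ-≡ a b (r + e) (begin
      a + b          ≡⟨ a+b≡2r ⟩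
      r + r          ≡⟨ cong (_+ r) a+e≡r ⟨
      a + e + r      ≡⟨ +-assoc a e r ⟩
      a + (e + r)    ≡⟨ cong (a +_) (+-comm e r) ⟩
      a + (r + e)    ∎)
      where open ≡-Reasoning

    ≤-half : ∀ {a b} → r ≤ b → a + b ≡ r + r → a ≤ r
    ≤-half {a} {b} r≤b a+b≡2r = +-cancelʳ-≤ r a r (≤-trans (+-monoʳ-≤ a r≤b) (≤-reflexive a+b≡2r))

    top-case : ∀ {a b} → ¬ Part r η a → ¬ Part r η b → a ≢ b → a + b ≡ r + r →
      MissingShape a → MissingShape b → ⊥
    top-case ¬a ¬b a≢b a+b≡2r (inj₂ (e , e∈ , a+e≡r)) _ = ¬b (shifted e∈ (complement-shift a+e≡r a+b≡2r))
    top-case {a} {b} ¬a ¬b a≢b a+b≡2r (inj₁ _) (inj₂ (e , e∈ , b+e≡r)) =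
      ¬a (shifted e∈ (complement-shift b+e≡r (trans (+-comm b a) a+b≡2r)))
    top-case {a} {b} ¬a ¬b a≢b a+b≡2r (inj₁ r≤a) (inj₁ r≤b) = a≢b (trans
      (≤-antisym (≤-half r≤b a+b≡2r) r≤a)
      (sym (≤-antisym (≤-half r≤a (trans (+-comm b a) a+b≡2r)) r≤b)))

    <k+k⇒≢r : ∀ {x} → x < k + k → x ≢ r
    <k+k⇒≢r x<2k = <⇒≢ (<-≤-trans x<2k k+k≤r)

    mixed-case : ∀ {a b e₂ e₃} → e₂ ∈ η → e₃ ∈ η → r ≤ a → b + e₂ ≡ r → a + b ≡ r + e₃ → ⊥
    mixed-case {a} {b} {e₂} {e₃} e₂∈ e₃∈ r≤a b+e₂≡r a+b≡r+e₃ = <k+k⇒≢r (begin-strict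
      b + e₂        ≤⟨ +-monoˡ-≤ e₂ b≤e₃ ⟩
      e₃ + e₂       <⟨ +-mono-< (η<k e₃∈) (η<k e₂∈) ⟩
      k + k         ∎) b+e₂≡r
      where
      open ≤-Reasoning
      b≤e₃ : b ≤ e₃
      b≤e₃ = +-cancelˡ-≤ r b e₃ (≤-trans (+-monoˡ-≤ b r≤a) (≤-reflexive a+b≡r+e₃))

    shifted-case : ∀ {a b e₃} → e₃ ∈ η → a ≢ b → a + b ≡ r + e₃ →
      MissingShape a → MissingShape b → ⊥
    shifted-case {a} {b} {e₃} e₃∈ a≢b a+b≡r+e₃ (inj₂ (e₁ , e₁∈ , a+e₁≡r)) (inj₂ (e₂ , e₂∈ , b+e₂≡r)) =
      <k+k⇒≢r (+-mono-<-≤ (η<k e₃∈) (η-pair e₁∈ e₂∈ e₁≢e₂)) (sym (+-cancelˡ-≡ r r _ (begin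
        r + r                    ≡⟨ cong₂ _+_ a+e₁≡r b+e₂≡r ⟨
        (a + e₁) + (b + e₂)      ≡⟨ interchange a e₁ b e₂ ⟩
        (a + b) + (e₁ + e₂)      ≡⟨ cong (_+ (e₁ + e₂)) a+b≡r+e₃ ⟩
        (r + e₃) + (e₁ + e₂)     ≡⟨ +-assoc r e₃ (e₁ + e₂) ⟩
        r + (e₃ + (e₁ + e₂))     ∎)))
      where
      open ≡-Reasoning
      e₁≢e₂ : e₁ ≢ e₂
      e₁≢e₂ refl = a≢b (+-cancelʳ-≡ e₁ a b (trans a+e₁≡r (sym b+e₂≡r)))
    shifted-case e₃∈ _ a+b≡r+e₃ (inj₁ r≤a) (inj₂ (_ , e₂∈ , b+e₂≡r)) =
      mixed-case e₂∈ e₃∈ r≤a b+e₂≡r a+b≡r+e₃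
    shifted-case {a} {b} e₃∈ _ a+b≡r+e₃ (inj₂ (_ , e₁∈ , a+e₁≡r)) (inj₁ r≤b) =
      mixed-case e₁∈ e₃∈ r≤b a+e₁≡r (trans (+-comm b a) a+b≡r+e₃)
    shifted-case {a} {b} {e₃} e₃∈ _ a+b≡r+e₃ (inj₁ r≤a) (inj₁ r≤b) =
      <⇒≱ (η<r e₃∈) (+-cancelˡ-≤ r r e₃ (≤-trans (+-mono-≤ r≤a r≤b) (≤-reflexive a+b≡r+e₃)))

    small-case : ∀ {a b} → a + b < r → MissingShape a → MissingShape b → ⊥
    small-case {a} {b} a+b<r (inj₁ r≤a) _ = <⇒≱ a+b<r (≤-trans r≤a (m≤m+n a b))
    small-case {a} {b} a+b<r _ (inj₁ r≤b) = <⇒≱ a+b<r (≤-trans r≤b (m≤n+m b a))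
    small-case {a} {b} a+b<r (inj₂ (e₁ , e₁∈ , a+e₁≡r)) (inj₂ (e₂ , e₂∈ , b+e₂≡r)) =
      <-irrefl refl (begin-strict
      r + r                    ≡⟨ cong₂ _+_ a+e₁≡r b+e₂≡r ⟨
      (a + e₁) + (b + e₂)      ≡⟨ interchange a e₁ b e₂ ⟩
      (a + b) + (e₁ + e₂)      <⟨ +-mono-< a+b<r (+-mono-< (η<k e₁∈) (η<k e₂∈)) ⟩
      r + (k + k)              ≤⟨ +-monoʳ-≤ r k+k≤r ⟩
      r + r                    ∎)
      where open ≤-Reasoning

  ¬Part-+ : ∀ {m₁ m₂} → 1 ≤ m₁ → 1 ≤ m₂ → ¬ Part r η m₁ → ¬ Part r η m₂ → m₁ ≢ m₂ →
    ¬ Part r η (m₁ + m₂)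
  ¬Part-+ m₁>0 m₂>0 ¬m₁ ¬m₂ m₁≢m₂ part with ¬Part⇒ m₁>0 ¬m₁ | ¬Part⇒ m₂>0 ¬m₂ | part
  ... | shape₁ | shape₂ | top eq        = top-case ¬m₁ ¬m₂ m₁≢m₂ eq shape₁ shape₂
  ... | shape₁ | shape₂ | shifted e∈ eq = shifted-case e∈ m₁≢m₂ eq shape₁ shape₂
  ... | shape₁ | shape₂ | small _ s<r _ = small-case s<r shape₁ shape₂

  unrefinable : ∀ {H} → (∀ {v} → v ∈ H ⇔ Part r η v) → Unrefinable H
  unrefinable H⇔ (m₁ , m₂ , (m₁>0 , _ , m₁∉H) , (m₂>0 , _ , m₂∉H) , m₁≢m₂ , m₁+m₂∈H) =
    ¬Part-+ m₁>0 m₂>0 (m₁∉H ∘ Equivalence.from H⇔) (m₂∉H ∘ Equivalence.from H⇔) m₁≢m₂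
            (Equivalence.to H⇔ m₁+m₂∈H)

  ¬Part[r+k] : ¬ Part r η (r + k)
  ¬Part[r+k] (top r+k≡2r)          = <⇒≢ k<r (+-cancelˡ-≡ r k r r+k≡2r)
  ¬Part[r+k] (shifted e∈ r+k≡r+e)  = <⇒≢ (η<k e∈) (sym (+-cancelˡ-≡ r k _ r+k≡r+e))
  ¬Part[r+k] (small _ r+k<r _)     = <⇒≱ r+k<r (m≤m+n r k)

  Part⇒≤2r : ∀ {v} → Part r η v → v ≤ r + r
  Part⇒≤2r (top refl)         = ≤-refl
  Part⇒≤2r (shifted e∈ refl)  = +-monoʳ-≤ r (<⇒≤ (η<r e∈))
  Part⇒≤2r (small _ v<r _)    = ≤-trans (<⇒≤ v<r) (m≤m+n r r)

  largest-parts : ∀ {H} → Linked _<_ H → (∀ {v} → v ∈ H ⇔ Part r η v) → largest H ≡ r + r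
  largest-parts {H} H↑ H⇔ = ≤-antisym (Part⇒≤2r (Equivalence.to H⇔ (∈⇒largest∈ 2r∈H))) (≤largest H↑ 2r∈H)
    where
    2r∈H : r + r ∈ H
    2r∈H = Equivalence.from H⇔ (top refl)

  module _ {H : List ℕ} (H-unique : Unique H) (H⇔ : ∀ {v} → v ∈ H ⇔ Part r η v) where

    private
      complements shifts : List ℕ
      complements = map (r ∸_) η
      shifts      = map (r +_) η

      η≤r : All (_≤ r) η
      η≤r = All.tabulate (<⇒≤ ∘ η<r)

      r∸e<r : ∀ {e} → e ∈ η → r ∸ e < r
      r∸e<r e∈ = ∸-monoʳ-< (η>0 e∈) (<⇒≤ (η<r e∈))

      ¬Part[r∸e] : ∀ {e} → e ∈ η → ¬ Part r η (r ∸ e)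
      ¬Part[r∸e] e∈ (top eq)          = <⇒≱ (r∸e<r e∈) (subst (r ≤_) (sym eq) (m≤m+n r r))
      ¬Part[r∸e] e∈ (shifted _ eq)    = <⇒≱ (r∸e<r e∈) (subst (r ≤_) (sym eq) (m≤m+n r _))
      ¬Part[r∸e] e∈ (small _ _ e∉)    = e∉ (subst (_∈ η) (sym (m∸[m∸n]≡n (<⇒≤ (η<r e∈)))) e∈)

      ¬Part[r] : ¬ Part r η r
      ¬Part[r] (top eq)            = <⇒≢ (m<m+n r r>0) eq
      ¬Part[r] (shifted e∈ eq)     = <⇒≢ (m<m+n r (η>0 e∈)) eq
      ¬Part[r] (small _ r<r _)     = <-irrefl refl r<r

      lhs-unique : Unique (r ∷ H ++ complements)
      lhs-unique = All.tabulate r∉ ∷ Unique.++⁺ H-unique complements-unique disjoint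
        where
        complements-unique : Unique complements
        complements-unique = Unique-map⁺-on (λ e≤r e′≤r → ∸-cancelˡ-≡ e≤r e′≤r) η≤r η-unique
        r∉ : ∀ {v} → v ∈ H ++ complements → r ≢ v
        r∉ v∈ refl with ∈-++⁻ H v∈
        ... | inj₁ r∈H = ¬Part[r] (Equivalence.to H⇔ r∈H)
        ... | inj₂ r∈c with e , e∈ , r≡r∸e ← ∈-map⁻ (r ∸_) r∈c = <⇒≢ (r∸e<r e∈) (sym r≡r∸e)
        disjoint : ∀ {v} → ¬ (v ∈ H × v ∈ complements)
        disjoint (v∈H , v∈c) with e , e∈ , refl ← ∈-map⁻ (r ∸_) v∈c =
          ¬Part[r∸e] e∈ (Equivalence.to H⇔ v∈H)

      rhs-unique : Unique (fromTo 1 r ++ (r + r) ∷ shifts)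
      rhs-unique = Unique.++⁺ (unique-fromTo r) (All.map⁺ (All.tabulate 2r≢) ∷ shifts-unique) disjoint
        where
        shifts-unique : Unique shifts
        shifts-unique = Unique.map⁺ (+-cancelˡ-≡ r _ _) η-unique
        2r≢ : ∀ {e} → e ∈ η → r + r ≢ r + e
        2r≢ e∈ eq = <⇒≢ (η<r e∈) (sym (+-cancelˡ-≡ r r _ eq))
        disjoint : ∀ {v} → ¬ (v ∈ fromTo 1 r × v ∈ (r + r) ∷ shifts)
        disjoint (v∈ , here refl) = <⇒≱ (m<m+n r r>0) (proj₂ (∈-fromTo⁻ v∈))
        disjoint (v∈ , there v∈s) with e , e∈ , refl ← ∈-map⁻ (r +_) v∈s =
          <⇒≱ (m<m+n r (η>0 e∈)) (proj₂ (∈-fromTo⁻ v∈))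

      lhs⊆rhs : ∀ {v} → v ∈ r ∷ H ++ complements → v ∈ fromTo 1 r ++ (r + r) ∷ shifts
      lhs⊆rhs (here refl) = ∈-++⁺ˡ (∈-fromTo⁺ r>0 ≤-refl)
      lhs⊆rhs (there v∈) with ∈-++⁻ H v∈
      ... | inj₂ v∈c with e , e∈ , refl ← ∈-map⁻ (r ∸_) v∈c =
        ∈-++⁺ˡ (∈-fromTo⁺ (m<n⇒0<n∸m (η<r e∈)) (m∸n≤m r e))
      ... | inj₁ v∈H with Equivalence.to H⇔ v∈H
      ...   | top refl          = ∈-++⁺ʳ (fromTo 1 r) (here refl)
      ...   | shifted e∈ refl   = ∈-++⁺ʳ (fromTo 1 r) (there (∈-map⁺ (r +_) e∈))
      ...   | small v>0 v<r _   = ∈-++⁺ˡ (∈-fromTo⁺ v>0 (<⇒≤ v<r))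

      rhs⊆lhs : ∀ {v} → v ∈ fromTo 1 r ++ (r + r) ∷ shifts → v ∈ r ∷ H ++ complements
      rhs⊆lhs {v} v∈ with ∈-++⁻ (fromTo 1 r) v∈
      ... | inj₂ (here refl) = there (∈-++⁺ˡ (Equivalence.from H⇔ (top refl)))
      ... | inj₂ (there v∈s) with e , e∈ , refl ← ∈-map⁻ (r +_) v∈s =
        there (∈-++⁺ˡ (Equivalence.from H⇔ (shifted e∈ refl)))
      ... | inj₁ v∈r with ∈-fromTo⁻ v∈r | v <? r
      ...   | _         , v≤r | no v≮r = subst (_∈ _) (≤-antisym (≮⇒≥ v≮r) v≤r) (here refl)
      ...   | v>0       , _   | yes v<r with (r ∸ v) ∈? η
      ...     | yes r-v∈ =
        there (∈-++⁺ʳ H (subst (_∈ complements) (m∸[m∸n]≡n (<⇒≤ v<r)) (∈-map⁺ (r ∸_) r-v∈)))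
      ...     | no  r-v∉ = there (∈-++⁺ˡ (Equivalence.from H⇔ (small v>0 v<r r-v∉)))

    sum-parts : sum H ≡ T r + r + (k + k)
    sum-parts = +-cancelʳ-≡ C _ _ (+-cancelˡ-≡ r _ _ (begin
      r + (sum H + C)                          ≡⟨ cong (r +_) (sum-++ H complements) ⟨
      sum (r ∷ H ++ complements)               ≡⟨ sum-↭ (unique∧set⇒↭ lhs-unique rhs-unique (mk⇔ lhs⊆rhs rhs⊆lhs)) ⟩
      sum (fromTo 1 r ++ (r + r) ∷ shifts)     ≡⟨ sum-++ (fromTo 1 r) _ ⟩
      sum (fromTo 1 r) + (r + r + sum shifts)  ≡⟨ cong₂ (λ t s → t + (r + r + s)) (sum-fromTo r) sum-shifts ⟩
      T r + (r + r + (C + (k + k)))            ≡⟨ rearrange (T r) r C k ⟩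
      r + (T r + r + (k + k) + C)              ∎))
      where
      open ≡-Reasoning
      C : ℕ
      C = sum complements
      sum-shifts : sum shifts ≡ C + (k + k)
      sum-shifts = trans (sum-map-+ r η η≤r) (cong (λ s → C + (s + s)) η-sum)
      rearrange : ∀ t r c k → t + (r + r + (c + (k + k))) ≡ r + (t + r + (k + k) + c)
      rearrange = solve-∀

-- The diagram Y_{2η*}

module Y2ηHooks (n : ℕ) (η : List ℕ) {Y : List ℕ} (young : YoungDiagram Y)
  (diagonal : (i : ℕ) → 1 ≤ i → (InDiagram Y i i → i ≤ suc (length η)) × (i ≤ suc (length η) → InDiagram Y i i))
  (hook₁₁ : hook Y 1 1 ≡ 2 * n ∸ 4)
  (hookᵢᵢ : (i : ℕ) → 2 ≤ i → i ≤ suc (length η) → hook Y i i ≡ 2 * at η (length η ∸ (i ∸ 2)))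
  (balanced : (i : ℕ) → 1 ≤ i → i ≤ suc (length η) → arm Y i i ≡ leg Y i i + 1) where

  private
    l : ℕ
    l = length η
    r : ℕ
    r = length Y

    onDiagonal : ∀ {p} → p < suc l → suc p ≤ rowLen Y (suc p)
    onDiagonal {p} p<d = proj₂ (proj₂ (proj₂ (diagonal (suc p) (s≤s z≤n)) p<d))

    offDiagonal : rowLen Y (suc (suc l)) ≤ suc l
    offDiagonal with suc (suc l) ≤? rowLen Y (suc (suc l))
    ... | yes l+2≤row =
      ⊥-elim (1+n≰n (proj₁ (diagonal (suc (suc l)) (s≤s z≤n)) (s≤s z≤n , s≤s z≤n , l+2≤row)))
    ... | no  l+2≰row = ≤-pred (≰⇒> l+2≰row)

  open Frobenius young (suc l) onDiagonal offDiagonal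

  private
    α≡1+β : ∀ {p} → p < suc l → α p ≡ suc (β p)
    α≡1+β {p} p<d = trans (balanced (suc p) (s≤s z≤n) p<d) (+-comm (β p) 1)

    hook≡2α : ∀ {p} → p < suc l → hook Y (suc p) (suc p) ≡ 2 * α p
    hook≡2α {p} p<d = begin
      α p + β p + 1     ≡⟨ +-assoc (α p) (β p) 1 ⟩
      α p + (β p + 1)   ≡⟨ cong (α p +_) (balanced (suc p) (s≤s z≤n) p<d) ⟨
      α p + α p         ≡⟨ cong (α p +_) (+-identityʳ (α p)) ⟨
      2 * α p           ∎
      where open ≡-Reasoning

    α₀≡r : α 0 ≡ r
    α₀≡r = trans (α≡1+β (s≤s z≤n)) (trans (sym (colLen≡ (s≤s z≤n))) (colLen-1 (proj₁ young)))

  r≡n∸2 : r ≡ n ∸ 2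
  r≡n∸2 = trans (sym α₀≡r) (*-cancelˡ-≡ (α 0) (n ∸ 2) 2 (begin
    2 * α 0          ≡⟨ hook≡2α (s≤s z≤n) ⟨
    hook Y 1 1       ≡⟨ hook₁₁ ⟩
    2 * n ∸ 4        ≡⟨ *-distribˡ-∸ 2 n 2 ⟨
    2 * (n ∸ 2)      ∎))
    where open ≡-Reasoning

  private
    α≡ηₗ₋q : ∀ {q} → q < l → α (suc q) ≡ at η (l ∸ q)
    α≡ηₗ₋q {q} q<l = *-cancelˡ-≡ _ _ 2
      (trans (sym (hook≡2α (s≤s q<l))) (hookᵢᵢ (suc (suc q)) (s≤s (s≤s z≤n)) (s≤s q<l)))

    α∈η : ∀ {q} → q < l → α (suc q) ∈ η
    α∈η {q} q<l = subst (_∈ η) (sym (trans (α≡ηₗ₋q q<l) (cong (at η) (+-∸-assoc 1 q<l))))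
      (at-∈ η (∸-monoʳ-< (s≤s z≤n) q<l))

    η⇒α : ∀ {e} → e ∈ η → ∃ λ q → q < l × α (suc q) ≡ e
    η⇒α e∈ with i , i<l , ηᵢ≡e ← ∈⇒at e∈ =
      l ∸ suc i , q<l , trans (α≡ηₗ₋q q<l) (trans (cong (at η) (m∸[m∸n]≡n i<l)) ηᵢ≡e)
      where
      q<l : l ∸ suc i < l
      q<l = ∸-monoʳ-< (s≤s z≤n) i<l

  hooks⇔Part : ∀ {v} → v ∈ betaNumbers Y ⇔ Part r η v
  hooks⇔Part = mk⇔ toPart fromPart
    where
    1+β₀≡r : suc (β 0) ≡ r
    1+β₀≡r = trans (sym (α≡1+β (s≤s z≤n))) α₀≡r

    legGap⇒α : ∀ {v q} → q < l → v + suc (β (suc q)) ≡ r → α (suc q) ≡ r ∸ v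
    legGap⇒α {v} {q} q<l gap = begin
      α (suc q)                  ≡⟨ m+n∸m≡n v (α (suc q)) ⟨
      v + α (suc q) ∸ v          ≡⟨ cong (λ a → v + a ∸ v) (α≡1+β (s≤s q<l)) ⟩
      v + suc (β (suc q)) ∸ v    ≡⟨ cong (_∸ v) gap ⟩
      r ∸ v                      ∎
      where open ≡-Reasoning

    toPart : ∀ {v} → v ∈ betaNumbers Y → Part r η v
    toPart {v} v∈ with ∈-betaNumbers⇒ v∈
    ... | inj₁ (zero  , _       , v≡r+α) = top (trans v≡r+α (cong (r +_) α₀≡r))
    ... | inj₁ (suc q , s≤s q<l , v≡r+α) = shifted (α∈η q<l) v≡r+α
    ... | inj₂ (v<r , ¬gap) = small (n≢0⇒n>0 v≢0) v<r r∸v∉η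
      where
      v≢0 : v ≢ 0
      v≢0 refl = ¬gap (0 , s≤s z≤n , 1+β₀≡r)
      r∸v∉η : r ∸ v ∉ η
      r∸v∉η r∸v∈ with q , q<l , α≡r∸v ← η⇒α r∸v∈ = ¬gap (suc q , s≤s q<l , (begin
        v + suc (β (suc q))   ≡⟨ cong (v +_) (α≡1+β (s≤s q<l)) ⟨
        v + α (suc q)         ≡⟨ cong (v +_) α≡r∸v ⟩
        v + (r ∸ v)           ≡⟨ m+[n∸m]≡n (<⇒≤ v<r) ⟩
        r                     ∎))
        where open ≡-Reasoning

    fromPart : ∀ {v} → Part r η v → v ∈ betaNumbers Y
    fromPart (top v≡2r) =
      subst (_∈ betaNumbers Y) (trans (cong (r +_) α₀≡r) (sym v≡2r)) (diagonalHook∈ (s≤s z≤n))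
    fromPart (shifted e∈ v≡r+e) with q , q<l , α≡e ← η⇒α e∈ =
      subst (_∈ betaNumbers Y) (trans (cong (r +_) α≡e) (sym v≡r+e)) (diagonalHook∈ (s≤s q<l))
    fromPart {v} (small v>0 v<r r∸v∉η) = ¬LegGap⇒∈ v<r ¬gap
      where
      ¬gap : ¬ LegGap v
      ¬gap (zero  , _       , gap) = <⇒≢ v>0 (sym (+-cancelʳ-≡ r v 0 (trans (cong (v +_) (sym 1+β₀≡r)) gap)))
      ¬gap (suc q , s≤s q<l , gap) = r∸v∉η (subst (_∈ η) (legGap⇒α q<l gap) (α∈η q<l))

module Y2ηPartition (n : ℕ) {k : ℕ} (8≤2k : 8 ≤ 2 * k) (2k≤n∸2 : 2 * k ≤ n ∸ 2)
  {η : List ℕ} (η∈𝔻 : DistinctPartition k η) {Y : List ℕ} (young : YoungDiagram Y)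
  (diagonal : (i : ℕ) → 1 ≤ i → (InDiagram Y i i → i ≤ suc (length η)) × (i ≤ suc (length η) → InDiagram Y i i))
  (hook₁₁ : hook Y 1 1 ≡ 2 * n ∸ 4)
  (hookᵢᵢ : (i : ℕ) → 2 ≤ i → i ≤ suc (length η) → hook Y i i ≡ 2 * at η (length η ∸ (i ∸ 2)))
  (balanced : (i : ℕ) → 1 ≤ i → i ≤ suc (length η) → arm Y i i ≡ leg Y i i + 1) where

  open Y2ηHooks n η young diagonal hook₁₁ hookᵢᵢ balanced

  private
    r : ℕ
    r = length Y
    H : List ℕ
    H = betaNumbers Y
    N : ℕ
    N = T₂ n (n ∸ 2 * k + 1)

    2k≤r : 2 * k ≤ r
    2k≤r = subst (2 * k ≤_) (sym r≡n∸2) 2k≤n∸2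

    2k≡k+k : 2 * k ≡ k + k
    2k≡k+k = cong (k +_) (+-identityʳ k)

    k+k≤r : k + k ≤ r
    k+k≤r = subst (_≤ r) 2k≡k+k 2k≤r

  open Parts η∈𝔻 k+k≤r

  private
    H>0 : All (1 ≤_) H
    H>0 = betaNumbers-positive (proj₁ young)

    H↑ : Linked _<_ H
    H↑ = betaNumbers-increasing (proj₂ young)

    sum-H : sum H ≡ T r + r + (k + k)
    sum-H = sum-parts (Linked<⇒Unique H↑) hooks⇔Part

    largest-H : largest H ≡ r + r
    largest-H = largest-parts H↑ hooks⇔Part

    sum-H≡N : sum H ≡ N
    sum-H≡N = begin
      sum H                ≡⟨ sum-H ⟩
      T r + r + (k + k)    ≡⟨ cong (T r + r +_) 2k≡k+k ⟨
      T r + r + 2 * k      ≡⟨ T₂≡T+r+2k {n} {k = k} (sym r≡n∸2) 2k≤r ⟨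
      N                    ∎
      where open ≡-Reasoning

    H∈𝔻 : DistinctPartition N H
    H∈𝔻 = H>0 , H↑ , subst (2 ≤_) (sym (length-betaNumbers Y)) 2≤r , sum-H≡N
      where
      2≤r : 2 ≤ r
      2≤r = ≤-trans (≤-trans (s≤s (s≤s z≤n)) 8≤2k) 2k≤r

    maximal : ∀ μ → DistinctPartition N μ → Unrefinable μ → largest μ ≤ largest H
    maximal μ (_ , _ , _ , sumμ≡N) unrefμ =
      subst (largest μ ≤_) (sym largest-H) (unrefinable⇒largest≤ r unrefμ sumμ≤)
      where
      open ≤-Reasoning
      sumμ≤ : sum μ ≤ T r + (r + r)
      sumμ≤ = begin
        sum μ                   ≡⟨ trans sumμ≡N (sym sum-H≡N) ⟩
        sum H                   ≡⟨ sum-H ⟩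
        T r + r + (k + k)       ≡⟨ +-assoc (T r) r (k + k) ⟩
        T r + (r + (k + k))     ≤⟨ +-monoʳ-≤ (T r) (+-monoʳ-≤ r k+k≤r) ⟩
        T r + (r + r)           ∎

    numMissing-H : numMissing H ≡ r
    numMissing-H = +-cancelʳ-≡ r _ _ (begin
      numMissing H + r            ≡⟨ cong (numMissing H +_) (length-betaNumbers Y) ⟨
      numMissing H + length H     ≡⟨ numMissing+length≡largest H>0 H↑ ⟩
      largest H                   ≡⟨ largest-H ⟩
      r + r                       ∎)
      where open ≡-Reasoning

  hooks-unrefinable : Unrefinable H
  hooks-unrefinable = unrefinable hooks⇔Part

  hooks∈Ū : InUbar N H
  hooks∈Ū = (H∈𝔻 , hooks-unrefinable , maximal) ,
            trans numMissing-H (sym (trans (cong (_/ 2) largest-H) ([m+m]/2≡m r)))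

  hooks≢ζ : H ≢ ζ n k
  hooks≢ζ H≡ζ = ¬Part[r+k] (Equivalence.to hooks⇔Part (subst (r + k ∈_) (sym H≡ζ) r+k∈ζ))
    where
    r+k∈ζ : r + k ∈ ζ n k
    r+k∈ζ = subst (λ m → m + k ∈ ζ n k) (sym r≡n∸2)
      (∈-++⁺ʳ (fromTo 1 (n ∸ k ∸ 3)) (∈-++⁺ʳ (fromTo (n ∸ k ∸ 1) (n ∸ 3)) (here refl)))

theorem5p3 : (n k : ℕ) → 8 ≤ 2 * k → 2 * k ≤ n ∸ 2 →
    (η : List ℕ) → DistinctPartition k η →
    (Y : List ℕ) → YoungDiagram Y →
    ((i : ℕ) → 1 ≤ i → (InDiagram Y i i → i ≤ suc (length η)) × (i ≤ suc (length η) → InDiagram Y i i)) →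
    hook Y 1 1 ≡ 2 * n ∸ 4 →
    ((i : ℕ) → 2 ≤ i → i ≤ suc (length η) → hook Y i i ≡ 2 * at η (length η ∸ (i ∸ 2))) →
    ((i : ℕ) → 1 ≤ i → i ≤ suc (length η) → arm Y i i ≡ leg Y i i + 1) →
    Unrefinable (firstColHooks Y)
    × (n ∸ 2 * k + 1 ≡ 3 → InUbar (T₂ n (n ∸ 2 * k + 1)) (firstColHooks Y))
    × (3 < n ∸ 2 * k + 1 → InUbar (T₂ n (n ∸ 2 * k + 1)) (firstColHooks Y) × firstColHooks Y ≢ ζ n k)
theorem5p3 n k 8≤2k 2k≤n∸2 η η∈𝔻 Y young diagonal hook₁₁ hookᵢᵢ balanced
  rewrite firstColHooks≡betaNumbers (proj₁ young) =
  hooks-unrefinable , (λ _ → hooks∈Ū) , (λ _ → hooks∈Ū , hooks≢ζ)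
  where open Y2ηPartition n 8≤2k 2k≤n∸2 η∈𝔻 young diagonal hook₁₁ hookᵢᵢ balanced
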